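{- Let $t\in\mathbb{N}$. Then there exists $m=m(t)\in\mathbb{N}$ such that for every $G\in\mathcal{C}_t$, $G$ does not contain a $(\leq2)$-subdivision of $K_m$ as a subgraph.
   Context: $\mathcal{C}$ is the class of graphs with no induced subgraph isomorphic to $C_4$, a theta (three internally disjoint paths of length $\ge2$ between two vertices with pairwise anticomplete interiors), a prism (three vertex-disjoint paths $a_i\cdots b_i$ of length $\ge1$ with $a_1a_2a_3$, $b_1b_2b_3$ triangles and no other edges between them), or an even wheel (a hole $H$, i.e. an induced cycle of length $\ge4$, plus a vertex with an even number, at least 4, of neighbors in $H$); $\mathcal{C}_t$ is the class of graphs in $\mathcal{C}$ with no clique of size $t$. For a graph $H$ and integer $p$, a $(\leq p)$-subdivision of $H$ is a graph obtained from $H$ by replacing each edge $uv$ by a path from $u$ to $v$ of length at least 1 and at most $p$, where the interiors of these paths are pairwise disjoint and anticomplete. -}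

module Defs where

open import Data.Nat using (ℕ; zero; suc; _<_; _≤_)
open import Data.Nat.Divisibility using (_∣_)
open import Data.Fin using (Fin; toℕ)
open import Data.Fin.Subset using (Subset; _∈_; ∣_∣)
open import Data.Bool using (Bool; true; false)
open import Data.Unit using (⊤; tt)
open import Data.Empty using (⊥)
open import Data.Sum using (_⊎_; inj₁; inj₂)
open import Data.Product using (Σ; _×_; _,_; ∃)
open import Relation.Binary.PropositionalEquality using (_≡_; _≢_)
open import Relation.Nullary using (¬_)
open import Function.Definitions using (Injective)

record Graph : Set where
  field
    n      : ℕ
    adj    : Fin n → Fin n → Bool
    sym    : ∀ u v → adj u v ≡ adj v u
    irrefl : ∀ v → adj v v ≡ false

  Adj : Fin n → Fin n → Set
  Adj u v = adj u v ≡ true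

open Graph public

-- Abstract "pattern graphs": a vertex type V and a generating edge
-- relation R; the adjacency is the symmetric closure of R.

SymC : {V : Set} → (V → V → Set) → V → V → Set
SymC R a b = R a b ⊎ R b a

HasInduced : (G : Graph) {V : Set} → (V → V → Set) → Set
HasInduced G {V} R =
  Σ (V → Fin (n G)) λ h → Injective _≡_ _≡_ h ×
    (∀ a b → (Adj G (h a) (h b) → SymC R a b) × (SymC R a b → Adj G (h a) (h b)))

HasSubgraph : (G : Graph) {V : Set} → (V → V → Set) → Set
HasSubgraph G {V} R =
  Σ (V → Fin (n G)) λ h → Injective _≡_ _≡_ h ×
    (∀ a b → SymC R a b → Adj G (h a) (h b))

CycleE : (L : ℕ) → Fin L → Fin L → Set
CycleE L i j = (suc (toℕ i) ≡ toℕ j) ⊎ ((suc (toℕ i) ≡ L) × (toℕ j ≡ 0))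

HasHole : Graph → ℕ → Set
HasHole G L = 4 ≤ L × HasInduced G (CycleE L)

HasC4 : Graph → Set
HasC4 G = HasInduced G (CycleE 4)

-- Theta: two vertices x = inj₁ 0, y = inj₁ 1 and three paths whose
-- interiors have k i ≥ 1 vertices (so each path has length k i + 1 ≥ 2).

ThetaV : (Fin 3 → ℕ) → Set
ThetaV k = Fin 2 ⊎ Σ (Fin 3) (λ i → Fin (k i))

ThetaE : (k : Fin 3 → ℕ) → ThetaV k → ThetaV k → Set
ThetaE k (inj₁ x) (inj₁ y) = ⊥
ThetaE k (inj₁ x) (inj₂ (i , p)) = (toℕ x ≡ 0) × (toℕ p ≡ 0)
ThetaE k (inj₂ (i , p)) (inj₁ y) = (toℕ y ≡ 1) × (suc (toℕ p) ≡ k i)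
ThetaE k (inj₂ (i , p)) (inj₂ (j , q)) = (i ≡ j) × (suc (toℕ p) ≡ toℕ q)

HasTheta : Graph → Set
HasTheta G = Σ (Fin 3 → ℕ) λ k → (∀ i → 1 ≤ k i) × HasInduced G (ThetaE k)

-- Prism: three vertex-disjoint paths with k i ≥ 2 vertices each
-- (length k i - 1 ≥ 1); first vertices a_i form a triangle, last
-- vertices b_i form a triangle; no other edges.

PrismV : (Fin 3 → ℕ) → Set
PrismV k = Σ (Fin 3) (λ i → Fin (k i))

PrismE : (k : Fin 3 → ℕ) → PrismV k → PrismV k → Set
PrismE k (i , p) (j , q) =
  ((i ≡ j) × (suc (toℕ p) ≡ toℕ q))
  ⊎ ((toℕ i < toℕ j) × (toℕ p ≡ 0) × (toℕ q ≡ 0))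
  ⊎ ((toℕ i < toℕ j) × (suc (toℕ p) ≡ k i) × (suc (toℕ q) ≡ k j))

HasPrism : Graph → Set
HasPrism G = Σ (Fin 3 → ℕ) λ k → (∀ i → 2 ≤ k i) × HasInduced G (PrismE k)

-- Even wheel: a hole of length L ≥ 4 (vertices inj₁ i) plus a centre
-- (inj₂ tt) adjacent exactly to the vertices of N, |N| even and ≥ 4.

WheelE : (L : ℕ) → Subset L → Fin L ⊎ ⊤ → Fin L ⊎ ⊤ → Set
WheelE L N (inj₁ i) (inj₁ j) = CycleE L i j
WheelE L N (inj₁ i) (inj₂ _) = ⊥
WheelE L N (inj₂ _) (inj₁ j) = j ∈ N
WheelE L N (inj₂ _) (inj₂ _) = ⊥

HasEvenWheel : Graph → Set
HasEvenWheel G = Σ ℕ λ L → Σ (Subset L) λ N →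
  4 ≤ L × 4 ≤ ∣ N ∣ × 2 ∣ ∣ N ∣ × HasInduced G (WheelE L N)

InC : Graph → Set
InC G = ¬ HasC4 G × ¬ HasTheta G × ¬ HasPrism G × ¬ HasEvenWheel G

HasClique : ℕ → Graph → Set
HasClique t G = Σ (Fin t → Fin (n G)) λ h → Injective _≡_ _≡_ h ×
  (∀ i j → i ≢ j → Adj G (h i) (h j))

InCt : ℕ → Graph → Set
InCt t G = InC G × ¬ HasClique t G

-- (≤2)-subdivision of K_m: branch vertices inj₁ i (i : Fin m); for each
-- pair i < j, s i j = false means the edge ij is kept (path length 1),
-- s i j = true means it is replaced by a path i - c - j through a new
-- vertex c = inj₂ ((i , j) , _) (path length 2).

SubdivV : (m : ℕ) → (Fin m → Fin m → Bool) → Set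
SubdivV m s = Fin m ⊎ Σ (Fin m × Fin m) λ { (i , j) → (toℕ i < toℕ j) × (s i j ≡ true) }

SubdivE : (m : ℕ) (s : Fin m → Fin m → Bool) → SubdivV m s → SubdivV m s → Set
SubdivE m s (inj₁ i) (inj₁ j) = (toℕ i < toℕ j) × (s i j ≡ false)
SubdivE m s (inj₁ k) (inj₂ ((i , j) , _)) = (k ≡ i) ⊎ (k ≡ j)
SubdivE m s (inj₂ _) (inj₁ k) = ⊥
SubdivE m s (inj₂ _) (inj₂ _) = ⊥

HasLe2SubdivK : ℕ → Graph → Set
HasLe2SubdivK m G = Σ (Fin m → Fin m → Bool) λ s → HasSubgraph G (SubdivE m s)

-- Apply Ramsey's theorem to pairs of branch vertices. As G has no K_t, a large set of pairwise
-- non-adjacent branch vertices remains, so every edge among them is subdivided by a middle vertex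
-- mid o x. Fix two of them as hubs a and b; two more Ramsey rounds make the spokes mid a x pairwise
-- non-adjacent, and likewise the mid b x. C4-freeness now says that a vertex non-adjacent to a hub
-- sees at most one of its spokes, and a few pigeonhole and Ramsey rounds based on this leave three
-- branch vertices x whose paths a – mid a x – x – mid b x – b (shortcut to a – mid a x – mid b x – b
-- when the two spokes at x are adjacent) are pairwise anticomplete: a theta.

module Submission where

open import Defs hiding (sym)
open import Data.Bool using (Bool; true; false)
import Data.Bool as Bool
open import Data.Empty using (⊥-elim)
open import Data.Unit using (⊤)
open import Data.Fin using (Fin; toℕ; suc)
open import Data.Fin.Patterns using (0F; 1F; 2F; 3F)
open import Data.Fin.Properties using (_≟_; toℕ<n; <⇒≢)
open import Data.Nat using (ℕ; zero; suc; _+_; _<_; _≤_; z≤n; s≤s)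
open import Data.Nat.Properties using (+-suc; suc-injective; _<?_)
open import Data.Vec using (Vec; []; _∷_; lookup; tabulate; allFin)
open import Data.Vec.Relation.Unary.All as All using (All; []; _∷_)
open import Data.Vec.Relation.Unary.All.Properties using (lookup⁺; tabulate⁺)
open import Data.Vec.Relation.Unary.AllPairs as AllPairs using (AllPairs; []; _∷_)
open import Data.Product using (Σ; ∃; _×_; _,_; proj₁; proj₂)
open import Data.Sum as Sum using (_⊎_; inj₁; inj₂)
open import Function using (_∘_; id)
open import Function.Definitions using (Injective)
open import Relation.Nullary using (¬_; Dec; yes; no)
open import Relation.Binary.PropositionalEquality using (_≡_; _≢_; refl; sym; trans; cong; subst; ≢-sym)

module _ {A : Set} where

  record Family (U : A → Set) (C : A → A → Set) (k : ℕ) : Set where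
    constructor family
    field
      members  : Vec A k
      all      : All U members
      pairwise : AllPairs C members

  private variable
    U U′ : A → Set
    C : A → A → Set
    k : ℕ

  empty : Family U C 0
  empty = family [] [] []

  cons : ∀ {v} → U v → Family (λ x → U x × C v x) C k → Family U C (suc k)
  cons Uv (family xs all pairs) =
    family (_ ∷ xs) (Uv ∷ All.map proj₁ all) (All.map proj₂ all ∷ pairs)

  uncons : Family U C (suc k) → Σ A λ v → U v × Family (λ x → U x × C v x) C k
  uncons (family (v ∷ xs) (Uv ∷ all) (Cv ∷ pairs)) =
    v , Uv , family xs (All.zip (all , Cv)) pairs

  mapᵘ : (∀ {x} → U x → U′ x) → Family U C k → Family U′ C k
  mapᵘ f (family xs all pairs) = family xs (All.map f all) pairs

  pigeonhole : ∀ {V : A → Set} → (∀ x → Dec (V x)) → ∀ i j → Family U C (i + j) →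
               Family (λ x → U x × V x) C i ⊎ Family (λ x → U x × ¬ V x) C j
  pigeonhole V? zero    j       F = inj₁ empty
  pigeonhole V? (suc i) zero    F = inj₂ empty
  pigeonhole V? (suc i) (suc j) F with uncons F
  ... | v , Uv , F′ with V? v
  ...   | yes Vv = Sum.map (cons (Uv , Vv) ∘ mapᵘ (λ ((Ux , Cvx) , Vx) → (Ux , Vx) , Cvx))
                           (mapᵘ (λ ((Ux , _) , ¬Vx) → Ux , ¬Vx))
                           (pigeonhole V? i (suc j) F′)
  ...   | no ¬Vv = Sum.map (mapᵘ (λ ((Ux , _) , Vx) → Ux , Vx))
                           (cons (Uv , ¬Vv) ∘ mapᵘ (λ ((Ux , Cvx) , ¬Vx) → (Ux , ¬Vx) , Cvx))
                           (pigeonhole V? (suc i) j (subst (Family _ _) (+-suc i j) F′))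

  triple : Family U C 3 →
           Σ (Fin 3 → A) λ x → (∀ i → U (x i)) × C (x 0F) (x 1F) × C (x 0F) (x 2F) × C (x 1F) (x 2F)
  triple (family (x₀ ∷ x₁ ∷ x₂ ∷ []) (U₀ ∷ U₁ ∷ U₂ ∷ []) ((C₀₁ ∷ C₀₂ ∷ []) ∷ (C₁₂ ∷ []) ∷ [] ∷ [])) =
    (λ { 0F → x₀ ; 1F → x₁ ; 2F → x₂ }) , (λ { 0F → U₀ ; 1F → U₁ ; 2F → U₂ }) , C₀₁ , C₀₂ , C₁₂

opaque
  ramseyBound : ℕ → ℕ → ℕ
  ramseyBound zero    r       = 0
  ramseyBound (suc s) zero    = 0
  ramseyBound (suc s) (suc r) = suc (ramseyBound s (suc r) + ramseyBound (suc s) r)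

  ramsey : ∀ {A : Set} {U : A → Set} {C P : A → A → Set} → (∀ x y → Dec (P x y)) → ∀ s r →
           Family U C (ramseyBound s r) →
           Family U (λ x y → C x y × P x y) s ⊎ Family U (λ x y → C x y × ¬ P x y) r
  ramsey P? zero    r       F = inj₁ empty
  ramsey P? (suc s) zero    F = inj₂ empty
  ramsey P? (suc s) (suc r) F with uncons F
  ... | v , Uv , F′ with pigeonhole (P? v) (ramseyBound s (suc r)) (ramseyBound (suc s) r) F′
  ...   | inj₁ Fᴾ = Sum.map (cons Uv ∘ mapᵘ (λ ((Ux , Cvx) , Pvx) → Ux , Cvx , Pvx))
                            (mapᵘ (proj₁ ∘ proj₁))
                            (ramsey P? s (suc r) Fᴾ)
  ...   | inj₂ Fⁿ = Sum.map (mapᵘ (proj₁ ∘ proj₁))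
                            (cons Uv ∘ mapᵘ (λ ((Ux , Cvx) , ¬Pvx) → Ux , Cvx , ¬Pvx))
                            (ramsey P? (suc s) r Fⁿ)

tabulate-increasing : ∀ {k m} {f : Fin k → Fin m} → (∀ {i j} → toℕ i < toℕ j → toℕ (f i) < toℕ (f j)) →
                      AllPairs (λ i j → toℕ i < toℕ j) (tabulate f)
tabulate-increasing {zero}  _    = []
tabulate-increasing {suc k} mono = tabulate⁺ (λ _ → mono (s≤s z≤n)) ∷ tabulate-increasing (mono ∘ s≤s)

hubFamilySize : ℕ
hubFamilySize = 2 + (2 + ramseyBound 3 (ramseyBound 3 (3 + 3)))

subdivisionBound : ℕ → ℕ
subdivisionBound t = ramseyBound t (suc (ramseyBound t (suc (ramseyBound t hubFamilySize))))

module Patterns (G : Graph) where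

  V : Set
  V = Fin (n G)

  infix 4 _~_
  _~_ : V → V → Set
  _~_ = Adj G

  ~-sym : ∀ {u v} → u ~ v → v ~ u
  ~-sym {u} {v} u~v = trans (Graph.sym G v u) u~v

  ~-irrefl : ∀ {v} → ¬ v ~ v
  ~-irrefl {v} v~v with trans (sym v~v) (irrefl G v)
  ... | ()

  ~⇒≢ : ∀ {u v} → u ~ v → u ≢ v
  ~⇒≢ u~v refl = ~-irrefl u~v

  _~?_ : ∀ u v → Dec (u ~ v)
  u ~? v = adj G u v Bool.≟ true

  hasC4 : ∀ {p q r s} → p ~ q → q ~ r → r ~ s → s ~ p →
          ¬ p ~ r → ¬ q ~ s → p ≢ r → q ≢ s → HasC4 G
  hasC4 {p} {q} {r} {s} p~q q~r r~s s~p p≁r q≁s p≢r q≢s =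
    h , injective , λ i j → adj⇒edge i j , edge⇒adj i j
    where
    corner : ℕ → V
    corner 0 = p
    corner 1 = q
    corner 2 = r
    corner _ = s

    h : Fin 4 → V
    h i = corner (toℕ i)

    step : ∀ k → suc k < 4 → corner k ~ corner (suc k)
    step 0 _ = p~q
    step 1 _ = q~r
    step 2 _ = r~s
    step (suc (suc (suc _))) (s≤s (s≤s (s≤s (s≤s ()))))

    edge : ∀ i j → CycleE 4 i j → h i ~ h j
    edge i j (inj₁ i+1≡j) =
      subst (λ k → h i ~ corner k) i+1≡j (step (toℕ i) (subst (_< 4) (sym i+1≡j) (toℕ<n j)))
    edge i j (inj₂ (i+1≡4 , j≡0)) rewrite suc-injective i+1≡4 | j≡0 = s~p

    edge⇒adj : ∀ i j → SymC (CycleE 4) i j → h i ~ h j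
    edge⇒adj i j (inj₁ e) = edge i j e
    edge⇒adj i j (inj₂ e) = ~-sym (edge j i e)

    adj⇒edge : ∀ i j → h i ~ h j → SymC (CycleE 4) i j
    adj⇒edge 0F 0F e = ⊥-elim (~-irrefl e)
    adj⇒edge 0F 1F _ = inj₁ (inj₁ refl)
    adj⇒edge 0F 2F e = ⊥-elim (p≁r e)
    adj⇒edge 0F 3F _ = inj₂ (inj₂ (refl , refl))
    adj⇒edge 1F 0F _ = inj₂ (inj₁ refl)
    adj⇒edge 1F 1F e = ⊥-elim (~-irrefl e)
    adj⇒edge 1F 2F _ = inj₁ (inj₁ refl)
    adj⇒edge 1F 3F e = ⊥-elim (q≁s e)
    adj⇒edge 2F 0F e = ⊥-elim (p≁r (~-sym e))
    adj⇒edge 2F 1F _ = inj₂ (inj₁ refl)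
    adj⇒edge 2F 2F e = ⊥-elim (~-irrefl e)
    adj⇒edge 2F 3F _ = inj₁ (inj₁ refl)
    adj⇒edge 3F 0F _ = inj₁ (inj₂ (refl , refl))
    adj⇒edge 3F 1F e = ⊥-elim (q≁s (~-sym e))
    adj⇒edge 3F 2F _ = inj₂ (inj₁ refl)
    adj⇒edge 3F 3F e = ⊥-elim (~-irrefl e)

    injective : Injective _≡_ _≡_ h
    injective {0F} {0F} _ = refl
    injective {0F} {1F} e = ⊥-elim (~⇒≢ p~q e)
    injective {0F} {2F} e = ⊥-elim (p≢r e)
    injective {0F} {3F} e = ⊥-elim (~⇒≢ s~p (sym e))
    injective {1F} {0F} e = ⊥-elim (~⇒≢ p~q (sym e))
    injective {1F} {1F} _ = refl
    injective {1F} {2F} e = ⊥-elim (~⇒≢ q~r e)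
    injective {1F} {3F} e = ⊥-elim (q≢s e)
    injective {2F} {0F} e = ⊥-elim (p≢r (sym e))
    injective {2F} {1F} e = ⊥-elim (~⇒≢ q~r (sym e))
    injective {2F} {2F} _ = refl
    injective {2F} {3F} e = ⊥-elim (~⇒≢ r~s e)
    injective {3F} {0F} e = ⊥-elim (~⇒≢ s~p e)
    injective {3F} {1F} e = ⊥-elim (q≢s (sym e))
    injective {3F} {2F} e = ⊥-elim (~⇒≢ r~s (sym e))
    injective {3F} {3F} _ = refl

  record ThetaFrame (k : ℕ) : Set where
    field
      x y : V
      path : Fin 3 → Fin k → V
      nonempty : 1 ≤ k
      x≁y : ¬ x ~ y
      x≢y : x ≢ y
      x~path⇒first : ∀ i p → x ~ path i p → toℕ p ≡ 0
      first⇒x~path : ∀ i p → toℕ p ≡ 0 → x ~ path i p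
      path~y⇒last : ∀ i p → path i p ~ y → suc (toℕ p) ≡ k
      last⇒path~y : ∀ i p → suc (toℕ p) ≡ k → path i p ~ y
      path~path⇒consecutive : ∀ i p q → path i p ~ path i q →
                              suc (toℕ p) ≡ toℕ q ⊎ suc (toℕ q) ≡ toℕ p
      consecutive⇒path~path : ∀ i p q → suc (toℕ p) ≡ toℕ q → path i p ~ path i q
      anticomplete : ∀ {i j} → i ≢ j → ∀ p q → ¬ path i p ~ path j q
      x≢path : ∀ i p → x ≢ path i p
      y≢path : ∀ i p → y ≢ path i p
      path-injective : ∀ i → Injective _≡_ _≡_ (path i)
      neighbour : ∀ i p → ∃ λ q → path i p ~ path i q

  hasTheta : ∀ {k} → ThetaFrame k → HasTheta G
  hasTheta {k} F = (λ _ → k) , (λ _ → nonempty) , h , injective , λ u v → adj⇒edge u v , edge⇒adj u v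
    where
    open ThetaFrame F

    h : ThetaV (λ _ → k) → V
    h (inj₁ 0F)       = x
    h (inj₁ 1F)       = y
    h (inj₂ (i , p)) = path i p

    edge : ∀ u v → ThetaE (λ _ → k) u v → h u ~ h v
    edge (inj₁ 0F)       (inj₂ (i , p))  (_ , e)    = first⇒x~path i p e
    edge (inj₂ (i , p)) (inj₁ 1F)       (_ , e)    = last⇒path~y i p e
    edge (inj₂ (i , p)) (inj₂ (.i , q)) (refl , e) = consecutive⇒path~path i p q e

    edge⇒adj : ∀ u v → SymC (ThetaE (λ _ → k)) u v → h u ~ h v
    edge⇒adj u v (inj₁ e) = edge u v e
    edge⇒adj u v (inj₂ e) = ~-sym (edge v u e)

    adj⇒edge : ∀ u v → h u ~ h v → SymC (ThetaE (λ _ → k)) u v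
    adj⇒edge (inj₁ 0F)       (inj₁ 0F)       e = ⊥-elim (~-irrefl e)
    adj⇒edge (inj₁ 0F)       (inj₁ 1F)       e = ⊥-elim (x≁y e)
    adj⇒edge (inj₁ 1F)       (inj₁ 0F)       e = ⊥-elim (x≁y (~-sym e))
    adj⇒edge (inj₁ 1F)       (inj₁ 1F)       e = ⊥-elim (~-irrefl e)
    adj⇒edge (inj₁ 0F)       (inj₂ (i , p)) e = inj₁ (refl , x~path⇒first i p e)
    adj⇒edge (inj₂ (i , p)) (inj₁ 0F)       e = inj₂ (refl , x~path⇒first i p (~-sym e))
    adj⇒edge (inj₁ 1F)       (inj₂ (i , p)) e = inj₂ (refl , path~y⇒last i p (~-sym e))
    adj⇒edge (inj₂ (i , p)) (inj₁ 1F)       e = inj₁ (refl , path~y⇒last i p e)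
    adj⇒edge (inj₂ (i , p)) (inj₂ (j , q)) e with i ≟ j
    ... | no i≢j  = ⊥-elim (anticomplete i≢j p q e)
    ... | yes refl = Sum.map (refl ,_) (refl ,_) (path~path⇒consecutive i p q e)

    injective : Injective _≡_ _≡_ h
    injective {inj₁ 0F}       {inj₁ 0F}       _ = refl
    injective {inj₁ 0F}       {inj₁ 1F}       e = ⊥-elim (x≢y e)
    injective {inj₁ 1F}       {inj₁ 0F}       e = ⊥-elim (x≢y (sym e))
    injective {inj₁ 1F}       {inj₁ 1F}       _ = refl
    injective {inj₁ 0F}       {inj₂ (i , p)} e = ⊥-elim (x≢path i p e)
    injective {inj₁ 1F}       {inj₂ (i , p)} e = ⊥-elim (y≢path i p e)
    injective {inj₂ (i , p)} {inj₁ 0F}       e = ⊥-elim (x≢path i p (sym e))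
    injective {inj₂ (i , p)} {inj₁ 1F}       e = ⊥-elim (y≢path i p (sym e))
    injective {inj₂ (i , p)} {inj₂ (j , q)} e with i ≟ j
    ... | yes refl = cong (λ r → inj₂ (i , r)) (path-injective i e)
    -- A vertex shared by two paths would make its neighbour on one path adjacent to the other.
    ... | no i≢j   = ⊥-elim (anticomplete (≢-sym i≢j) q p′ (subst (_~ path i p′) e p~p′))
      where
      p′ = proj₁ (neighbour i p)
      p~p′ = proj₂ (neighbour i p)

  hasClique : ∀ {A : Set} {U : A → Set} {C : A → A → Set} {t} (f : A → V) →
              (∀ {x y} → C x y → f x ~ f y) → Family U C t → HasClique t G
  hasClique f C⇒~ (family xs _ pairs) = h , injective , adjacent
    where
    h = λ i → f (lookup xs i)

    lookup-adjacent : ∀ {k} {ys : Vec _ k} → AllPairs (λ u v → f u ~ f v) ys →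
                      ∀ i j → i ≢ j → f (lookup ys i) ~ f (lookup ys j)
    lookup-adjacent (_ ∷ _)   0F      0F      0≢0 = ⊥-elim (0≢0 refl)
    lookup-adjacent (a ∷ _)   0F      (suc j) _   = lookup⁺ a j
    lookup-adjacent (a ∷ _)   (suc i) 0F      _   = ~-sym (lookup⁺ a i)
    lookup-adjacent (_ ∷ as) (suc i) (suc j) i≢j = lookup-adjacent as i j (i≢j ∘ cong suc)

    adjacent : ∀ i j → i ≢ j → h i ~ h j
    adjacent = lookup-adjacent (AllPairs.map C⇒~ pairs)

    injective : Injective _≡_ _≡_ h
    injective {i} {j} e with i ≟ j
    ... | yes i≡j = i≡j
    ... | no i≢j  = ⊥-elim (~⇒≢ (adjacent i j i≢j) e)

module Subdivision (G : Graph) {m : ℕ} (s : Fin m → Fin m → Bool)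
  (h : SubdivV m s → Fin (n G)) (h-injective : Injective _≡_ _≡_ h)
  (h-edges : ∀ u v → SymC (SubdivE m s) u v → Adj G (h u) (h v)) where

  open Patterns G

  branch : Fin m → V
  branch i = h (inj₁ i)

  NonEdge : Fin m → Fin m → Set
  NonEdge i j = toℕ i < toℕ j × ¬ branch i ~ branch j

  -- inj₁ o is a junk value, returned when o < x fails or the edge ox is not subdivided.
  midName′ : ∀ o x → Dec (toℕ o < toℕ x) → (c : Bool) → s o x ≡ c → SubdivV m s
  midName′ o x (yes o<x) true s≡true = inj₂ ((o , x) , o<x , s≡true)
  midName′ o x _          _    _      = inj₁ o

  midName : Fin m → Fin m → SubdivV m s
  midName o x = midName′ o x (toℕ o <? toℕ x) (s o x) refl

  mid : Fin m → Fin m → V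
  mid o x = h (midName o x)

  private variable
    i j o o′ x x′ : Fin m

  midName-nonEdge : NonEdge o x → ∃ λ p → midName o x ≡ inj₂ ((o , x) , p)
  midName-nonEdge {o} {x} (o<x , o≁x) = view (toℕ o <? toℕ x) (s o x) refl
    where
    view : ∀ d c (s≡c : s o x ≡ c) → ∃ λ p → midName′ o x d c s≡c ≡ inj₂ ((o , x) , p)
    view (yes o<x′) true  s≡true  = (o<x′ , s≡true) , refl
    view (yes o<x′) false s≡false = ⊥-elim (o≁x (h-edges (inj₁ o) (inj₁ x) (inj₁ (o<x′ , s≡false))))
    view (no o≮x)   _     _       = ⊥-elim (o≮x o<x)

  branch~midˡ : NonEdge o x → branch o ~ mid o x
  branch~midˡ {o} {x} ox with midName o x | midName-nonEdge ox
  ... | _ | p , refl = h-edges (inj₁ o) (inj₂ ((o , x) , p)) (inj₁ (inj₁ refl))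

  branch~midʳ : NonEdge o x → branch x ~ mid o x
  branch~midʳ {o} {x} ox with midName o x | midName-nonEdge ox
  ... | _ | p , refl = h-edges (inj₁ x) (inj₂ ((o , x) , p)) (inj₁ (inj₂ refl))

  mid≢branch : NonEdge o x → mid o x ≢ branch i
  mid≢branch {o} {x} ox e with midName o x | midName-nonEdge ox | h-injective e
  ... | _ | _ , refl | ()

  mid-injective : NonEdge o x → NonEdge o′ x′ → mid o x ≡ mid o′ x′ → o ≡ o′ × x ≡ x′
  mid-injective {o} {x} {o′} {x′} ox ox′ e
    with midName o x | midName-nonEdge ox | midName o′ x′ | midName-nonEdge ox′ | h-injective e
  ... | _ | _ , refl | _ | _ , refl | refl = refl , refl

  branch≢ : i ≢ j → branch i ≢ branch j
  branch≢ i≢j e with h-injective e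
  ... | refl = i≢j refl

  module C4Free (noC4 : ¬ HasC4 G) where

    at-most-one-spoke : ∀ {y v} → NonEdge o x → NonEdge o y → x ≢ y → ¬ mid o x ~ mid o y →
                        ¬ v ~ branch o → v ≢ branch o → v ~ mid o x → ¬ v ~ mid o y
    at-most-one-spoke ox oy x≢y mx≁my v≁o v≢o v~mx v~my =
      noC4 (hasC4 (branch~midˡ ox) (~-sym v~mx) v~my (~-sym (branch~midˡ oy))
                  (v≁o ∘ ~-sym) mx≁my (v≢o ∘ sym) (x≢y ∘ proj₂ ∘ mid-injective ox oy))

    branch-misses-spoke : ∀ {y} → NonEdge o x → NonEdge o y → x ≢ y → ¬ mid o x ~ mid o y →
                          ¬ branch y ~ mid o x
    branch-misses-spoke ox oy x≢y mx≁my =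
      at-most-one-spoke oy ox (≢-sym x≢y) (mx≁my ∘ ~-sym) (proj₂ oy ∘ ~-sym)
                        (branch≢ (≢-sym (<⇒≢ (proj₁ oy)))) (branch~midʳ oy)

    module Hubs (noTheta : ¬ HasTheta G) (a b : Fin m) (ab : NonEdge a b) where

      Spoked : Fin m → Set
      Spoked x = NonEdge a x × NonEdge b x

      Separated : Fin m → Fin m → Set
      Separated x y = (NonEdge x y × ¬ mid a x ~ mid a y) × ¬ mid b x ~ mid b y

      Clean : Fin m → Set
      Clean x = (Spoked x × ¬ mid a x ~ branch b) × ¬ mid b x ~ branch a

      FullySeparated : Fin m → Fin m → Set
      FullySeparated x y = (Separated x y × ¬ mid a x ~ mid b y) × ¬ mid a y ~ mid b x

      separated⇒≢ : ∀ {x y} → Separated x y → x ≢ y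
      separated⇒≢ (((x<y , _) , _) , _) = <⇒≢ x<y

      a≢b : branch a ≢ branch b
      a≢b = branch≢ (<⇒≢ (proj₁ ab))

      ¬two-a-spokes-see-b : ¬ Family (λ x → Spoked x × mid a x ~ branch b) Separated 2
      ¬two-a-spokes-see-b
        (family (_ ∷ _ ∷ []) (((ax , _) , x~b) ∷ ((ay , _) , y~b) ∷ []) ((xy ∷ []) ∷ _)) =
        at-most-one-spoke ax ay (separated⇒≢ xy) (proj₂ (proj₁ xy)) (proj₂ ab ∘ ~-sym) (a≢b ∘ sym)
                          (~-sym x~b) (~-sym y~b)

      ¬two-b-spokes-see-a :
        ¬ Family (λ x → (Spoked x × ¬ mid a x ~ branch b) × mid b x ~ branch a) Separated 2
      ¬two-b-spokes-see-a
        (family (_ ∷ _ ∷ []) ((((_ , bx) , _) , x~a) ∷ (((_ , by) , _) , y~a) ∷ []) ((xy ∷ []) ∷ _)) =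
        at-most-one-spoke bx by (separated⇒≢ xy) (proj₂ xy) (proj₂ ab) a≢b (~-sym x~a) (~-sym y~a)

      ¬a-spoke-sees-two-b-spokes : ¬ Family Clean (λ x y → Separated x y × mid a x ~ mid b y) 3
      ¬a-spoke-sees-two-b-spokes
        (family (_ ∷ _ ∷ _ ∷ [])
                ((((ax , _) , ax≁b) , _) ∷ (((_ , by) , _) , _) ∷ (((_ , bz) , _) , _) ∷ [])
                (((_ , x~y) ∷ (_ , x~z) ∷ []) ∷ ((yz , _) ∷ []) ∷ _)) =
        at-most-one-spoke by bz (separated⇒≢ yz) (proj₂ yz) ax≁b (mid≢branch ax) x~y x~z

      ¬b-spoke-sees-two-a-spokes :
        ¬ Family Clean (λ x y → (Separated x y × ¬ mid a x ~ mid b y) × mid a y ~ mid b x) 3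
      ¬b-spoke-sees-two-a-spokes
        (family (_ ∷ _ ∷ _ ∷ [])
                ((((_ , bx) , _) , bx≁a) ∷ (((ay , _) , _) , _) ∷ (((az , _) , _) , _) ∷ [])
                (((_ , y~x) ∷ (_ , z~x) ∷ []) ∷ (((yz , _) , _) ∷ []) ∷ _)) =
        at-most-one-spoke ay az (separated⇒≢ yz) (proj₂ (proj₁ yz)) bx≁a (mid≢branch bx) (~-sym y~x) (~-sym z~x)

      spokePath : Fin m → Fin 3 → V
      spokePath x 0F = mid a x
      spokePath x 1F = branch x
      spokePath x 2F = mid b x

      Apart : Fin m → Fin m → Set
      Apart x y = ∀ p q → ¬ spokePath x p ~ spokePath y q

      apart : ∀ {x y} → Clean x → Clean y → FullySeparated x y → Apart x y
      apart {x} {y} (((ax , bx) , _) , _) (((ay , by) , _) , _)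
            (((((x<y , x≁y) , ax≁ay) , bx≁by) , ax≁by) , ay≁bx) = x-y
        where
        x≢y = <⇒≢ x<y

        x-y : Apart x y
        x-y 0F 0F = ax≁ay
        x-y 0F 1F = branch-misses-spoke ax ay x≢y ax≁ay ∘ ~-sym
        x-y 0F 2F = ax≁by
        x-y 1F 0F = branch-misses-spoke ay ax (≢-sym x≢y) (ax≁ay ∘ ~-sym)
        x-y 1F 1F = x≁y
        x-y 1F 2F = branch-misses-spoke by bx (≢-sym x≢y) (bx≁by ∘ ~-sym)
        x-y 2F 0F = ay≁bx ∘ ~-sym
        x-y 2F 1F = branch-misses-spoke bx by x≢y bx≁by ∘ ~-sym
        x-y 2F 2F = bx≁by

      apart-sym : ∀ {x y} → Apart x y → Apart y x
      apart-sym xy p q = xy q p ∘ ~-sym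

      module Triple (leg : Fin 3 → Fin m) (clean : ∀ i → Clean (leg i))
                    (s₀₁ : FullySeparated (leg 0F) (leg 1F))
                    (s₀₂ : FullySeparated (leg 0F) (leg 2F))
                    (s₁₂ : FullySeparated (leg 1F) (leg 2F)) where

        hub-a : ∀ i → NonEdge a (leg i)
        hub-a = proj₁ ∘ proj₁ ∘ proj₁ ∘ clean

        hub-b : ∀ i → NonEdge b (leg i)
        hub-b = proj₂ ∘ proj₁ ∘ proj₁ ∘ clean

        ¬sees-b : ∀ i → ¬ mid a (leg i) ~ branch b
        ¬sees-b = proj₂ ∘ proj₁ ∘ clean

        ¬sees-a : ∀ i → ¬ mid b (leg i) ~ branch a
        ¬sees-a = proj₂ ∘ clean

        apartness : ∀ {i j} → i ≢ j → Apart (leg i) (leg j)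
        apartness {0F} {0F} 0≢0 = ⊥-elim (0≢0 refl)
        apartness {0F} {1F} _   = apart (clean 0F) (clean 1F) s₀₁
        apartness {0F} {2F} _   = apart (clean 0F) (clean 2F) s₀₂
        apartness {1F} {0F} _   = apart-sym (apart (clean 0F) (clean 1F) s₀₁)
        apartness {1F} {1F} 1≢1 = ⊥-elim (1≢1 refl)
        apartness {1F} {2F} _   = apart (clean 1F) (clean 2F) s₁₂
        apartness {2F} {0F} _   = apart-sym (apart (clean 0F) (clean 2F) s₀₂)
        apartness {2F} {1F} _   = apart-sym (apart (clean 1F) (clean 2F) s₁₂)
        apartness {2F} {2F} 2≢2 = ⊥-elim (2≢2 refl)

        a≢spoke : ∀ i p → branch a ≢ spokePath (leg i) p
        a≢spoke i 0F = mid≢branch (hub-a i) ∘ sym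
        a≢spoke i 1F = branch≢ (<⇒≢ (proj₁ (hub-a i)))
        a≢spoke i 2F = mid≢branch (hub-b i) ∘ sym

        b≢spoke : ∀ i p → branch b ≢ spokePath (leg i) p
        b≢spoke i 0F = mid≢branch (hub-a i) ∘ sym
        b≢spoke i 1F = branch≢ (<⇒≢ (proj₁ (hub-b i)))
        b≢spoke i 2F = mid≢branch (hub-b i) ∘ sym

        spoke-injective : ∀ i → Injective _≡_ _≡_ (spokePath (leg i))
        spoke-injective i {0F} {0F} _ = refl
        spoke-injective i {0F} {1F} eq = ⊥-elim (mid≢branch (hub-a i) eq)
        spoke-injective i {0F} {2F} eq = ⊥-elim (<⇒≢ (proj₁ ab) (proj₁ (mid-injective (hub-a i) (hub-b i) eq)))
        spoke-injective i {1F} {0F} eq = ⊥-elim (mid≢branch (hub-a i) (sym eq))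
        spoke-injective i {1F} {1F} _ = refl
        spoke-injective i {1F} {2F} eq = ⊥-elim (mid≢branch (hub-b i) (sym eq))
        spoke-injective i {2F} {0F} eq = ⊥-elim (<⇒≢ (proj₁ ab) (proj₁ (mid-injective (hub-a i) (hub-b i) (sym eq))))
        spoke-injective i {2F} {1F} eq = ⊥-elim (mid≢branch (hub-b i) eq)
        spoke-injective i {2F} {2F} _ = refl

        chordless-frame : (∀ i → ¬ mid a (leg i) ~ mid b (leg i)) → ThetaFrame 3
        chordless-frame chordless = record
          { x = branch a
          ; y = branch b
          ; path = spokePath ∘ leg
          ; nonempty = s≤s z≤n
          ; x≁y = proj₂ ab
          ; x≢y = a≢b
          ; x~path⇒first = x~path⇒first
          ; first⇒x~path = first⇒x~path
          ; path~y⇒last = path~y⇒last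
          ; last⇒path~y = last⇒path~y
          ; path~path⇒consecutive = path~path⇒consecutive
          ; consecutive⇒path~path = consecutive⇒path~path
          ; anticomplete = apartness
          ; x≢path = a≢spoke
          ; y≢path = b≢spoke
          ; path-injective = spoke-injective
          ; neighbour = neighbour
          }
          where
          x~path⇒first : ∀ i p → branch a ~ spokePath (leg i) p → toℕ p ≡ 0
          x~path⇒first i 0F _  = refl
          x~path⇒first i 1F a~ = ⊥-elim (proj₂ (hub-a i) a~)
          x~path⇒first i 2F a~ = ⊥-elim (¬sees-a i (~-sym a~))

          first⇒x~path : ∀ i p → toℕ p ≡ 0 → branch a ~ spokePath (leg i) p
          first⇒x~path i 0F _ = branch~midˡ (hub-a i)

          path~y⇒last : ∀ i p → spokePath (leg i) p ~ branch b → suc (toℕ p) ≡ 3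
          path~y⇒last i 0F ~b = ⊥-elim (¬sees-b i ~b)
          path~y⇒last i 1F ~b = ⊥-elim (proj₂ (hub-b i) (~-sym ~b))
          path~y⇒last i 2F _  = refl

          last⇒path~y : ∀ i p → suc (toℕ p) ≡ 3 → spokePath (leg i) p ~ branch b
          last⇒path~y i 2F _ = ~-sym (branch~midˡ (hub-b i))

          path~path⇒consecutive : ∀ i p q → spokePath (leg i) p ~ spokePath (leg i) q →
                                  suc (toℕ p) ≡ toℕ q ⊎ suc (toℕ q) ≡ toℕ p
          path~path⇒consecutive i 0F 0F ~ = ⊥-elim (~-irrefl ~)
          path~path⇒consecutive i 0F 1F _ = inj₁ refl
          path~path⇒consecutive i 0F 2F ~ = ⊥-elim (chordless i ~)
          path~path⇒consecutive i 1F 0F _ = inj₂ refl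
          path~path⇒consecutive i 1F 1F ~ = ⊥-elim (~-irrefl ~)
          path~path⇒consecutive i 1F 2F _ = inj₁ refl
          path~path⇒consecutive i 2F 0F ~ = ⊥-elim (chordless i (~-sym ~))
          path~path⇒consecutive i 2F 1F _ = inj₂ refl
          path~path⇒consecutive i 2F 2F ~ = ⊥-elim (~-irrefl ~)

          consecutive⇒path~path : ∀ i p q → suc (toℕ p) ≡ toℕ q → spokePath (leg i) p ~ spokePath (leg i) q
          consecutive⇒path~path i 0F 1F _ = ~-sym (branch~midʳ (hub-a i))
          consecutive⇒path~path i 1F 2F _ = branch~midʳ (hub-b i)

          neighbour : ∀ i p → ∃ λ q → spokePath (leg i) p ~ spokePath (leg i) q
          neighbour i 0F = 1F , ~-sym (branch~midʳ (hub-a i))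
          neighbour i 1F = 2F , branch~midʳ (hub-b i)
          neighbour i 2F = 1F , ~-sym (branch~midʳ (hub-b i))

        ends : Fin 2 → Fin 3
        ends 0F = 0F
        ends 1F = 2F

        ends-injective : Injective _≡_ _≡_ ends
        ends-injective {0F} {0F} _  = refl
        ends-injective {0F} {1F} ()
        ends-injective {1F} {0F} ()
        ends-injective {1F} {1F} _  = refl

        chorded-frame : (∀ i → mid a (leg i) ~ mid b (leg i)) → ThetaFrame 2
        chorded-frame chord = record
          { x = branch a
          ; y = branch b
          ; path = λ i → spokePath (leg i) ∘ ends
          ; nonempty = s≤s z≤n
          ; x≁y = proj₂ ab
          ; x≢y = a≢b
          ; x~path⇒first = x~path⇒first
          ; first⇒x~path = first⇒x~path
          ; path~y⇒last = path~y⇒last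
          ; last⇒path~y = last⇒path~y
          ; path~path⇒consecutive = path~path⇒consecutive
          ; consecutive⇒path~path = consecutive⇒path~path
          ; anticomplete = λ i≢j p q → apartness i≢j (ends p) (ends q)
          ; x≢path = λ i → a≢spoke i ∘ ends
          ; y≢path = λ i → b≢spoke i ∘ ends
          ; path-injective = λ i → ends-injective ∘ spoke-injective i
          ; neighbour = neighbour
          }
          where
          x~path⇒first : ∀ i p → branch a ~ spokePath (leg i) (ends p) → toℕ p ≡ 0
          x~path⇒first i 0F _  = refl
          x~path⇒first i 1F a~ = ⊥-elim (¬sees-a i (~-sym a~))

          first⇒x~path : ∀ i p → toℕ p ≡ 0 → branch a ~ spokePath (leg i) (ends p)
          first⇒x~path i 0F _ = branch~midˡ (hub-a i)

          path~y⇒last : ∀ i p → spokePath (leg i) (ends p) ~ branch b → suc (toℕ p) ≡ 2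
          path~y⇒last i 0F ~b = ⊥-elim (¬sees-b i ~b)
          path~y⇒last i 1F _  = refl

          last⇒path~y : ∀ i p → suc (toℕ p) ≡ 2 → spokePath (leg i) (ends p) ~ branch b
          last⇒path~y i 1F _ = ~-sym (branch~midˡ (hub-b i))

          path~path⇒consecutive : ∀ i p q → spokePath (leg i) (ends p) ~ spokePath (leg i) (ends q) →
                                  suc (toℕ p) ≡ toℕ q ⊎ suc (toℕ q) ≡ toℕ p
          path~path⇒consecutive i 0F 0F ~ = ⊥-elim (~-irrefl ~)
          path~path⇒consecutive i 0F 1F _ = inj₁ refl
          path~path⇒consecutive i 1F 0F _ = inj₂ refl
          path~path⇒consecutive i 1F 1F ~ = ⊥-elim (~-irrefl ~)

          consecutive⇒path~path : ∀ i p q → suc (toℕ p) ≡ toℕ q →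
                                  spokePath (leg i) (ends p) ~ spokePath (leg i) (ends q)
          consecutive⇒path~path i 0F 1F _ = chord i

          neighbour : ∀ i p → ∃ λ q → spokePath (leg i) (ends p) ~ spokePath (leg i) (ends q)
          neighbour i 0F = 1F , chord i
          neighbour i 1F = 0F , ~-sym (chord i)

      ¬chorded-triple : ¬ Family (λ x → Clean x × mid a x ~ mid b x) FullySeparated 3
      ¬chorded-triple F with triple F
      ... | leg , clean , s₀₁ , s₀₂ , s₁₂ =
        noTheta (hasTheta (Triple.chorded-frame leg (proj₁ ∘ clean) s₀₁ s₀₂ s₁₂ (proj₂ ∘ clean)))

      ¬chordless-triple : ¬ Family (λ x → Clean x × ¬ mid a x ~ mid b x) FullySeparated 3
      ¬chordless-triple F with triple F
      ... | leg , clean , s₀₁ , s₀₂ , s₁₂ =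
        noTheta (hasTheta (Triple.chordless-frame leg (proj₁ ∘ clean) s₀₁ s₀₂ s₁₂ (proj₂ ∘ clean)))

      no-hub-family : ¬ Family Spoked Separated hubFamilySize
      no-hub-family F
        with pigeonhole (λ x → mid a x ~? branch b) 2 _ F
      ... | inj₁ F′ = ¬two-a-spokes-see-b F′
      ... | inj₂ F₁
        with pigeonhole (λ x → mid b x ~? branch a) 2 _ F₁
      ... | inj₁ F′ = ¬two-b-spokes-see-a F′
      ... | inj₂ F₂
        -- The relations are directed by list order: in a homogeneous triple the spoke of the
        -- first element sees the spokes of both later ones.
        with ramsey (λ x y → mid a x ~? mid b y) 3 (ramseyBound 3 (3 + 3)) F₂
      ... | inj₁ F′ = ¬a-spoke-sees-two-b-spokes F′
      ... | inj₂ F₃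
        with ramsey (λ x y → mid a y ~? mid b x) 3 (3 + 3) F₃
      ... | inj₁ F′ = ¬b-spoke-sees-two-a-spokes F′
      ... | inj₂ F₄
        with pigeonhole (λ x → mid a x ~? mid b x) 3 3 F₄
      ... | inj₁ F′ = ¬chorded-triple F′
      ... | inj₂ F′ = ¬chordless-triple F′

    no-large-family : ¬ HasTheta G → ∀ t → ¬ HasClique t G →
                      ¬ Family (λ _ → ⊤) (λ i j → toℕ i < toℕ j) (subdivisionBound t)
    no-large-family noTheta t noClique F
      with ramsey (λ i j → branch i ~? branch j) t (suc (ramseyBound t (suc (ramseyBound t hubFamilySize)))) F
    ... | inj₁ K = noClique (hasClique branch proj₂ K)
    ... | inj₂ F₀
      with uncons F₀
    ... | a , _ , F₁
      with ramsey (λ i j → mid a i ~? mid a j) t (suc (ramseyBound t hubFamilySize)) F₁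
    ... | inj₁ K = noClique (hasClique (mid a) proj₂ K)
    ... | inj₂ F₂
      with uncons F₂
    ... | b , (_ , ab) , F₃
      with ramsey (λ i j → mid b i ~? mid b j) t hubFamilySize F₃
    ... | inj₁ K = noClique (hasClique (mid b) proj₂ K)
    ... | inj₂ F₄ = Hubs.no-hub-family noTheta a b ab (mapᵘ (λ ((_ , ax) , (bx , _)) → ax , bx) F₄)

lemma6p2 : (t : ℕ) → ∃ λ (m : ℕ) → (G : Graph) → InCt t G → ¬ HasLe2SubdivK m G
lemma6p2 t = subdivisionBound t , λ G ((noC4 , noTheta , _) , noClique) (s , h , h-injective , h-edges) →
  Subdivision.C4Free.no-large-family G s h h-injective h-edges noC4 noTheta t noClique
    (family (allFin _) (All.universal _ _) (tabulate-increasing id))
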